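{- Let $J_1 = [9]\setminus\{1\}$. There exist subsets $I_2, I_3, \dots, I_9 \subseteq [4]$, each of size $3$, such that, with $\mathcal I = (I_2, \dots, I_9)$, the conditional predicate $R_2 \mid S_2$ is an $\mathcal I$-substructure of $\pi_{J_1}\operatorname{BoolBCK} \mid \pi_{J_1}\operatorname{BoolBCK}^{+}$.
   Context: $C_6 = \{(0,0),(0,1),(1,0),(1,2),(2,1),(2,2)\}$, $C_6^*=C_6\setminus\{(0,0)\}$, $S_2 = C_6\times C_6\subseteq\{0,1,2\}^4$, $R_2 = (C_6^*\times C_6)\cup(C_6\times C_6^*)$. $\operatorname{BoolBCK}^{+} = \{100010001, 010100001, 001010100, 100001010, 001100010, 010001100\}\subseteq\{0,1\}^9$ and $\operatorname{BoolBCK} = \operatorname{BoolBCK}^{+}\setminus\{100010001\}$; $\pi_{J_1}$ restricts to coordinates $2,\dots,9$, so the target predicates have arity $8$ with coordinates indexed by $2,\dots,9$. For $I\subseteq[r]$, $\pi_I x = (x_i: i\in I)$. For $P\subsetneq Q\subseteq D_1^{r_1}$, $R\subsetneq S\subseteq D_2^{r_2}$ and a sequence $\mathcal I=(I_j)$ of subsets of $[r_1]$ indexed by the $r_2$ output coordinates, $P\mid Q$ is an $\mathcal I$-substructure of $R\mid S$ if there exist maps $g_j : D_1^{I_j}\to D_2$ with $(g_j(\pi_{I_j}x))_j\in R$ for all $x\in P$ and $\in S\setminus R$ for all $x\in Q\setminus P$. -}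

module Defs where

open import Data.Bool using (Bool; true; false; _∧_; _∨_; T)
open import Data.Fin using (Fin; zero; suc)
open import Data.Fin.Subset using (Subset; _∈_)
open import Data.Nat using (ℕ)
open import Data.Product using (Σ; _×_; _,_; proj₁)
open import Data.List using (List; []; _∷_)
open import Data.List.Relation.Unary.Any using (Any)
open import Data.Vec using (Vec; []; _∷_; lookup)
open import Relation.Binary.PropositionalEquality using (_≡_)
open import Relation.Nullary using (¬_)

Rel : Set → ℕ → Set₁
Rel D r = (Fin r → D) → Set

π : {D : Set} {r : ℕ} (I : Subset r) → (Fin r → D) → (Σ (Fin r) (λ i → i ∈ I) → D)
π I x = λ p → x (proj₁ p)

IsSubstructure : {D₁ D₂ : Set} {r₁ r₂ : ℕ} →
  Rel D₁ r₁ → Rel D₁ r₁ → Rel D₂ r₂ → Rel D₂ r₂ → (Fin r₂ → Subset r₁) → Set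
IsSubstructure {D₁} {D₂} {r₁} {r₂} P Q R S I =
  Σ ((j : Fin r₂) → ((Σ (Fin r₁) (λ i → i ∈ I j)) → D₁) → D₂) λ g →
    ((x : Fin r₁ → D₁) → P x → R (λ j → g j (π (I j) x))) ×
    ((x : Fin r₁ → D₁) → Q x → ¬ P x →
        S (λ j → g j (π (I j) x)) × ¬ R (λ j → g j (π (I j) x)))

C6 : Fin 3 → Fin 3 → Bool
C6 zero zero = true
C6 zero (suc zero) = true
C6 (suc zero) zero = true
C6 (suc zero) (suc (suc zero)) = true
C6 (suc (suc zero)) (suc zero) = true
C6 (suc (suc zero)) (suc (suc zero)) = true
C6 _ _ = false

C6* : Fin 3 → Fin 3 → Bool
C6* zero zero = false
C6* a b = C6 a b

-- coordinates of [4] as Fin 4: 1 ↦ 0, 2 ↦ 1, 3 ↦ 2, 4 ↦ 3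
c₁ c₂ c₃ c₄ : Fin 4
c₁ = zero
c₂ = suc zero
c₃ = suc (suc zero)
c₄ = suc (suc (suc zero))

S2 : Rel (Fin 3) 4
S2 x = T (C6 (x c₁) (x c₂) ∧ C6 (x c₃) (x c₄))

R2 : Rel (Fin 3) 4
R2 x = T ((C6* (x c₁) (x c₂) ∧ C6 (x c₃) (x c₄)) ∨ (C6 (x c₁) (x c₂) ∧ C6* (x c₃) (x c₄)))

-- BoolBCK⁺ ⊆ {0,1}⁹ (coordinates 1..9 stored at Vec positions 0..8)
w₁ w₂ w₃ w₄ w₅ w₆ : Vec Bool 9
w₁ = true  ∷ false ∷ false ∷ false ∷ true  ∷ false ∷ false ∷ false ∷ true  ∷ []
w₂ = false ∷ true  ∷ false ∷ true  ∷ false ∷ false ∷ false ∷ false ∷ true  ∷ []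
w₃ = false ∷ false ∷ true  ∷ false ∷ true  ∷ false ∷ true  ∷ false ∷ false ∷ []
w₄ = true  ∷ false ∷ false ∷ false ∷ false ∷ true  ∷ false ∷ true  ∷ false ∷ []
w₅ = false ∷ false ∷ true  ∷ true  ∷ false ∷ false ∷ false ∷ true  ∷ false ∷ []
w₆ = false ∷ true  ∷ false ∷ false ∷ false ∷ true  ∷ true  ∷ false ∷ false ∷ []

BoolBCK+ : List (Vec Bool 9)
BoolBCK+ = w₁ ∷ w₂ ∷ w₃ ∷ w₄ ∷ w₅ ∷ w₆ ∷ []

BoolBCK : List (Vec Bool 9)
BoolBCK = w₂ ∷ w₃ ∷ w₄ ∷ w₅ ∷ w₆ ∷ []

-- π_{J₁} L for J₁ = {2,…,9}: output coordinate k : Fin 8 stands for original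
-- coordinate k+2, i.e. Vec position suc k.
πJ₁ : List (Vec Bool 9) → Rel Bool 8
πJ₁ L y = Any (λ w → (k : Fin 8) → y k ≡ lookup w (suc k)) L

{-# OPTIONS --safe #-}

-- BoolBCK⁺ is the set of 3 × 3 permutation matrices read row by row, w₁ being
-- the identity, and BoolBCK the set of non-identity ones.  So it suffices to
-- assign to every x ∈ C₆ × C₆ a permutation σₓ of {1,2,3}, with σₓ = id exactly
-- at x = 0000, such that every matrix entry except (1,1), which π_{J₁} drops,
-- depends on three coordinates of x: row 2 on x₂x₃x₄, row 3 on x₁x₃x₄, entry
-- (1,2) on x₁x₂x₄ and entry (1,3) on x₁x₂x₃.  The properties of the
-- assignment below are then a finite check over {0,1,2}⁴.

module Submission where

open import Defs
open import Data.Bool using (Bool; true; false)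
open import Data.Bool.Properties using () renaming (_≟_ to _≟ᵇ_)
open import Data.Fin using (Fin; suc; _≟_)
open import Data.Fin.Patterns using (0F; 1F; 2F; 3F; 4F; 5F; 6F; 7F)
open import Data.Fin.Properties using (all?)
open import Data.Fin.Subset using (Subset; ∣_∣; _∈_; ∁; ⁅_⁆)
open import Data.Fin.Subset.Properties using (_∈?_; ∣∁p∣≡n∸∣p∣; ∣⁅x⁆∣≡1)
open import Data.List.Relation.Unary.Any as Any using (any?)
open import Data.Nat using (suc; _∸_)
open import Data.Product using (Σ; _×_; _,_; proj₁; proj₂; map)
open import Data.Vec using (lookup)
open import Function using (_∘_)
open import Relation.Binary.PropositionalEquality using (_≡_; _≗_; refl; sym; trans; cong)
open import Relation.Nullary using (¬_; Dec)
open import Relation.Nullary.Decidable using (True; toWitness; T?; ¬?; _×-dec_; _→-dec_; ⌊_⌋)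

∣∁⁅i⁆∣≡n : ∀ {n} (i : Fin (suc n)) → ∣ ∁ ⁅ i ⁆ ∣ ≡ n
∣∁⁅i⁆∣≡n {n} i = trans (∣∁p∣≡n∸∣p∣ ⁅ i ⁆) (cong (suc n ∸_) (∣⁅x⁆∣≡1 i))

πJ₁? : ∀ L y → Dec (πJ₁ L y)
πJ₁? L y = any? (λ w → all? (λ k → y k ≟ᵇ lookup w (suc k))) L

πJ₁-resp-≗ : ∀ L {y y′} → y ≗ y′ → πJ₁ L y → πJ₁ L y′
πJ₁-resp-≗ L y≗y′ = Any.map (λ y≡w k → trans (sym (y≗y′ k)) (y≡w k))

_!_ : ∀ {r} {D : Set} {I : Subset r} → (Σ (Fin r) (_∈ I) → D) → (i : Fin r) → {True (i ∈? I)} → D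
(f ! i) {i∈I} = f (i , toWitness i∈I)

-- σ[i] returns the column σₓ(i), numbered from 0F; σ[1]≡k is the entry (1,k).
σ[2] σ[3] : Fin 3 → Fin 3 → Fin 3 → Fin 3
σ[2] 2F _  _  = 2F
σ[2] _  2F _  = 2F
σ[2] 0F _  0F = 1F
σ[2] 0F _  _  = 0F
σ[2] 1F 0F _  = 0F
σ[2] _  _  _  = 2F

σ[3] 0F 0F _  = 2F
σ[3] 0F _  2F = 1F
σ[3] 0F _  _  = 0F
σ[3] 1F _  0F = 0F
σ[3] _  _  _  = 1F

σ[1]≡2 σ[1]≡3 : Fin 3 → Fin 3 → Fin 3 → Bool
σ[1]≡2 0F _  1F = true
σ[1]≡2 0F 1F 0F = true
σ[1]≡2 1F 2F 0F = true
σ[1]≡2 _  _  _  = false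

σ[1]≡3 _  0F 1F = true
σ[1]≡3 1F 0F 0F = true
σ[1]≡3 2F 1F 0F = true
σ[1]≡3 _  _  _  = false

ignored : Fin 8 → Fin 4
ignored 0F = c₃
ignored 1F = c₄
ignored 2F = c₁
ignored 3F = c₁
ignored 4F = c₁
ignored _  = c₂

I : Fin 8 → Subset 4
I j = ∁ ⁅ ignored j ⁆

-- Output coordinate j stands for coordinate j + 2 of BoolBCK⁺, i.e. entry
-- (1,2), (1,3), (2,1), (2,2), (2,3), (3,1), (3,2), (3,3) of the matrix.
g : (j : Fin 8) → (Σ (Fin 4) (λ i → i ∈ I j) → Fin 3) → Bool
g 0F f = σ[1]≡2 (f ! c₁) (f ! c₂) (f ! c₄)
g 1F f = σ[1]≡3 (f ! c₁) (f ! c₂) (f ! c₃)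
g 2F f = ⌊ σ[2] (f ! c₂) (f ! c₃) (f ! c₄) ≟ 0F ⌋
g 3F f = ⌊ σ[2] (f ! c₂) (f ! c₃) (f ! c₄) ≟ 1F ⌋
g 4F f = ⌊ σ[2] (f ! c₂) (f ! c₃) (f ! c₄) ≟ 2F ⌋
g 5F f = ⌊ σ[3] (f ! c₁) (f ! c₃) (f ! c₄) ≟ 0F ⌋
g 6F f = ⌊ σ[3] (f ! c₁) (f ! c₃) (f ! c₄) ≟ 1F ⌋
g 7F f = ⌊ σ[3] (f ! c₁) (f ! c₃) (f ! c₄) ≟ 2F ⌋

image : (Fin 4 → Fin 3) → Fin 8 → Bool
image x j = g j (π (I j) x)

quadruple : Fin 3 → Fin 3 → Fin 3 → Fin 3 → Fin 4 → Fin 3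
quadruple a _ _ _ 0F = a
quadruple _ b _ _ 1F = b
quadruple _ _ c _ 2F = c
quadruple _ _ _ d 3F = d

image-quadruple : ∀ x → image x ≗ image (quadruple (x c₁) (x c₂) (x c₃) (x c₄))
image-quadruple x 0F = refl
image-quadruple x 1F = refl
image-quadruple x 2F = refl
image-quadruple x 3F = refl
image-quadruple x 4F = refl
image-quadruple x 5F = refl
image-quadruple x 6F = refl
image-quadruple x 7F = refl

GadgetCorrectAt : (Fin 4 → Fin 3) → Set
GadgetCorrectAt x =
  (R2 x → πJ₁ BoolBCK (image x)) ×
  (S2 x → ¬ R2 x → πJ₁ BoolBCK+ (image x) × ¬ πJ₁ BoolBCK (image x))

gadgetCorrectAt? : ∀ x → Dec (GadgetCorrectAt x)
gadgetCorrectAt? x =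
  (T? _ →-dec πJ₁? BoolBCK (image x)) ×-dec
  (T? _ →-dec (¬? (T? _) →-dec (πJ₁? BoolBCK+ (image x) ×-dec ¬? (πJ₁? BoolBCK (image x)))))

gadgetCorrectAt-quadruple : ∀ a b c d → GadgetCorrectAt (quadruple a b c d)
gadgetCorrectAt-quadruple = toWitness {a? = all? λ a → all? λ b → all? λ c → all? λ d →
  gadgetCorrectAt? (quadruple a b c d)} _

-- R2 and S2 read x only through x c₁ … x c₄, so they agree definitionally on
-- x and q; the images of x and q agree only pointwise.
gadgetCorrect : ∀ x → GadgetCorrectAt x
gadgetCorrect x =
  πJ₁-resp-≗ BoolBCK image-q≗image-x ∘ sound ,
  λ s ¬r → map (πJ₁-resp-≗ BoolBCK+ image-q≗image-x)
               (_∘ πJ₁-resp-≗ BoolBCK (image-quadruple x))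
               (complete s ¬r)
  where
  q : Fin 4 → Fin 3
  q = quadruple (x c₁) (x c₂) (x c₃) (x c₄)

  image-q≗image-x : image q ≗ image x
  image-q≗image-x = sym ∘ image-quadruple x

  sound : R2 q → πJ₁ BoolBCK (image q)
  sound = proj₁ (gadgetCorrectAt-quadruple (x c₁) (x c₂) (x c₃) (x c₄))

  complete : S2 q → ¬ R2 q → πJ₁ BoolBCK+ (image q) × ¬ πJ₁ BoolBCK (image q)
  complete = proj₂ (gadgetCorrectAt-quadruple (x c₁) (x c₂) (x c₃) (x c₄))

lemma4p8 : Σ (Fin 8 → Subset 4) (λ I →
             ((j : Fin 8) → ∣ I j ∣ ≡ 3) ×
             IsSubstructure R2 S2 (πJ₁ BoolBCK) (πJ₁ BoolBCK+) I)
lemma4p8 = I , ∣∁⁅i⁆∣≡n ∘ ignored , g ,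
  proj₁ ∘ gadgetCorrect , proj₂ ∘ gadgetCorrect
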